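{- Suppose that for every skew-symmetrizable integer $n\times n$ matrix $B_0$ (for every $n$) and all vertices $t_0,t$ of $\mathbb{T}_n$, the matrix $D_t^{B_0;t_0}$ has signed columns. Then the following two statements are equivalent: (a) For every skew-symmetrizable $B_0$, every edge $t_0\overset{k}{ - }t_1$ of $\mathbb{T}_n$ such that all entries in row $k$ of $B_0$ weakly agree in sign (all $\ge0$ or all $\le0$), with $B_1=\mu_k(B_0)$, and every vertex $t$: $D_t^{B_1;t_1}=J_kD_t^{B_0;t_0}+\bigl[|B_0^{k\bullet}|\,D_t^{B_0;t_0}\bigr]_+$. (b) For every skew-symmetrizable $B_0$, every edge $t_0\overset{k}{ - }t_1$ such that all entries in row $k$ of $B_0$ weakly agree in sign, with $B_1=\mu_k(B_0)$, and every vertex $t$: $D_t^{B_1;t_1}=\sigma_kD_t^{B_0;t_0}$, where $\sigma_k$ is defined using the entries of $B_0$.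
   Context: $\mathbb{T}_n$ is the $n$-regular tree whose edges are labeled by $1,\dots,n$ so that the $n$ edges at each vertex have distinct labels; $t\overset{k}{ - }t'$ means an edge labeled $k$. $[a]_+=\max(a,0)$. For a skew-symmetrizable integer matrix $B=(b_{ij})$, the mutation $\mu_k(B)=(b'_{ij})$ has $b'_{ij}=-b_{ij}$ if $i=k$ or $j=k$, and $b'_{ij}=b_{ij}+\mathrm{sgn}(b_{ik})[b_{ik}b_{kj}]_+$ otherwise. Given $B_0$ and a vertex $t_0$, the coefficient-free cluster pattern assigns to each vertex $t$ an exchange matrix $B_t^{B_0;t_0}=(b_{ij;t})$ and cluster $(x_{1;t},\dots,x_{n;t})$ in $\mathbb{Q}(x_1,\dots,x_n)$ with $B_{t_0}=B_0$, $x_{i;t_0}=x_i$, and for each edge $t\overset{k}{ - }t'$: $B_{t'}=\mu_k(B_t)$, $x_{j;t'}=x_{j;t}$ ($j\ne k$), $x_{k;t'}x_{k;t}=\prod_\ell x_{\ell;t}^{[b_{\ell k;t}]_+}+\prod_\ell x_{\ell;t}^{[-b_{\ell k;t}]_+}$. Each $x_{j;t}^{B_0;t_0}$ is a Laurent polynomial in $x_1,\dots,x_n$. $D_t^{B_0;t_0}$ has $(i,j)$ entry equal to minus the lowest power of $x_i$ in the Laurent expansion of $x_{j;t}^{B_0;t_0}$ (columns are $\mathbf{d}$-vectors). A matrix has signed columns if each column has all entries $\ge0$ or all entries $\le0$. $A^{k\bullet}$ is $A$ with all entries outside row $k$ replaced by $0$; $J_k$ is the identity matrix with $(k,k)$ entry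 replaced by $-1$; $|\cdot|$ and $[\cdot]_+$ act entrywise. For $B_0=(b_{ij})$ and an integer vector $v\in\mathbb{Z}^n$, $\sigma_k(v)$ is defined by $\sigma_k(v)_i=v_i$ for $i\ne k$ and $\sigma_k(v)_k=-v_k+\sum_{\ell=1}^n|b_{k\ell}|\,[v_\ell]_+$; $\sigma_k$ is applied to a matrix column by column. (Equivalently, $\sigma_k$ is the piecewise-linear modification of the simple reflection $s_k$ of the Cartan companion of $B_0$, acting on simple-root coordinates.) -}

module Defs where

open import Data.Nat using (ℕ; zero; suc)
open import Data.Integer using (ℤ; +_; -[1+_]; _+_; _*_; -_; ∣_∣; _≤_; _⊔_; 0ℤ; 1ℤ; _<_)
open import Data.Fin using (Fin; _≟_)
open import Data.List using (List; []; _∷_; _++_; concatMap; map)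
open import Data.Vec using (Vec; lookup; tabulate; zipWith)
open import Data.Vec.Properties using (≡-dec)
open import Data.Bool using (Bool; true; false; T; not; _∧_; if_then_else_)
open import Data.Unit using (⊤; tt)
open import Data.Empty using (⊥-elim)
open import Data.Product using (Σ; _×_; _,_; ∃; proj₁; proj₂)
open import Data.Sum using (_⊎_)
open import Relation.Nullary using (¬_; yes; no; Dec)
open import Relation.Nullary.Decidable using (⌊_⌋)
open import Relation.Binary.PropositionalEquality using (_≡_; _≢_)
import Data.Integer.Properties as ℤP

[_]₊ : ℤ → ℤ
[ a ]₊ = a ⊔ 0ℤ

-- [a]_+ as a natural number (used as an exponent)
pos : ℤ → ℕ
pos (+ m) = m
pos -[1+ _ ] = 0

∣_∣ℤ : ℤ → ℤ
∣ a ∣ℤ = + ∣ a ∣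

sgn : ℤ → ℤ
sgn (+ zero) = 0ℤ
sgn (+ suc _) = 1ℤ
sgn -[1+ _ ] = - 1ℤ

sumFin : ∀ {n} → (Fin n → ℤ) → ℤ
sumFin {zero} f = 0ℤ
sumFin {suc n} f = f Fin.zero + sumFin (λ i → f (Fin.suc i))
  where import Data.Fin as Fin

Mat : ℕ → Set
Mat n = Fin n → Fin n → ℤ

eqF : ∀ {n} → Fin n → Fin n → Bool
eqF i j = ⌊ i ≟ j ⌋

_·ᴹ_ : ∀ {n} → Mat n → Mat n → Mat n
(A ·ᴹ B) i j = sumFin (λ l → A i l * B l j)

_+ᴹ_ : ∀ {n} → Mat n → Mat n → Mat n
(A +ᴹ B) i j = A i j + B i j

∣_∣ᴹ : ∀ {n} → Mat n → Mat n
∣ A ∣ᴹ i j = ∣ A i j ∣ℤ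

[_]₊ᴹ : ∀ {n} → Mat n → Mat n
[ A ]₊ᴹ i j = [ A i j ]₊

row-only : ∀ {n} → Fin n → Mat n → Mat n
row-only k A i j = if eqF i k then A i j else 0ℤ

J : ∀ {n} → Fin n → Mat n
J k i j = if eqF i j then (if eqF i k then - 1ℤ else 1ℤ) else 0ℤ

SkewSymmetrizable : ∀ {n} → Mat n → Set
SkewSymmetrizable {n} B =
  Σ (Fin n → ℕ) λ d → (∀ i → 0 Data.Nat.< d i) × (∀ i j → + d i * B i j ≡ - (+ d j * B j i))
  where import Data.Nat

mutate : ∀ {n} → Fin n → Mat n → Mat n
mutate k B i j =
  if eqF i k then - B i j
  else if eqF j k then - B i j
  else B i j + sgn (B i k) * [ B i k * B k j ]₊

SignedColumns : ∀ {n} → Mat n → Set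
SignedColumns {n} D = ∀ j → (∀ i → 0ℤ ≤ D i j) ⊎ (∀ i → D i j ≤ 0ℤ)

RowSignCoherent : ∀ {n} → Mat n → Fin n → Set
RowSignCoherent {n} B k = (∀ l → 0ℤ ≤ B k l) ⊎ (∀ l → B k l ≤ 0ℤ)

σ : ∀ {n} → Mat n → Fin n → Mat n → Mat n
σ B k D i j =
  if eqF i k then - D k j + sumFin (λ l → ∣ B k l ∣ℤ * [ D l j ]₊)
  else D i j

-- The n-regular tree 𝕋_n: vertices are reduced words over Fin n
-- (no two adjacent letters equal), stored with the most recent letter
-- first; the edge labelled k joins t and step k t.

isReduced : ∀ {n} → List (Fin n) → Bool
isReduced [] = true
isReduced (x ∷ []) = true
isReduced (x ∷ y ∷ l) = not (eqF x y) ∧ isReduced (y ∷ l)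

Vertex : ℕ → Set
Vertex n = Σ (List (Fin n)) (λ w → T (isReduced w))

private
  tail-red : ∀ {n} (h : Fin n) (l : List (Fin n)) → T (isReduced (h ∷ l)) → T (isReduced l)
  tail-red h [] p = tt
  tail-red h (y ∷ l) p with eqF h y
  ... | true = ⊥-elim p
  ... | false = p

  cons-red : ∀ {n} (k h : Fin n) (l : List (Fin n)) → ¬ (k ≡ h) →
             T (isReduced (h ∷ l)) → T (isReduced (k ∷ h ∷ l))
  cons-red k h l k≢h p with k ≟ h
  ... | yes e = ⊥-elim (k≢h e)
  ... | no _ = p

step : ∀ {n} → Fin n → Vertex n → Vertex n
step k ([] , _) = (k ∷ [] , tt)
step k (h ∷ l , p) with k ≟ h
... | yes _ = (l , tail-red h l p)
... | no k≢h = (k ∷ h ∷ l , cons-red k h l k≢h p)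

-- Laurent polynomials in x_1..x_n with integer coefficients:
-- finite formal sums of terms c · x^e (e ∈ ℤ^n), compared by coefficients.

LPoly : ℕ → Set
LPoly n = List (ℤ × Vec ℤ n)

coeff : ∀ {n} → LPoly n → Vec ℤ n → ℤ
coeff [] e = 0ℤ
coeff ((c , e') ∷ p) e with ≡-dec ℤP._≟_ e' e
... | yes _ = c + coeff p e
... | no _ = coeff p e

_≈_ : ∀ {n} → LPoly n → LPoly n → Set
p ≈ q = ∀ e → coeff p e ≡ coeff q e

_⊕_ : ∀ {n} → LPoly n → LPoly n → LPoly n
p ⊕ q = p ++ q

_⊗_ : ∀ {n} → LPoly n → LPoly n → LPoly n
p ⊗ q = concatMap (λ { (c , e) → map (λ { (c' , e') → (c * c' , zipWith _+_ e e') }) q }) p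

one : ∀ {n} → LPoly n
one = (1ℤ , tabulate (λ _ → 0ℤ)) ∷ []

var : ∀ {n} → Fin n → LPoly n
var i = (1ℤ , tabulate (λ j → if eqF j i then 1ℤ else 0ℤ)) ∷ []

_^ᴸ_ : ∀ {n} → LPoly n → ℕ → LPoly n
p ^ᴸ zero = one
p ^ᴸ suc m = p ⊗ (p ^ᴸ m)

prodFin : ∀ {n m} → (Fin m → LPoly n) → LPoly n
prodFin {m = zero} f = one
prodFin {m = suc m} f = f Fin.zero ⊗ prodFin (λ i → f (Fin.suc i))
  where import Data.Fin as Fin

MinusLowestPower : ∀ {n} → LPoly n → Fin n → ℤ → Set
MinusLowestPower {n} p i d =
  (∃ λ (e : Vec ℤ n) → (coeff p e ≢ 0ℤ) × (lookup e i ≡ - d))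
  × (∀ (e : Vec ℤ n) → coeff p e ≢ 0ℤ → - d ≤ lookup e i)

-- Coefficient-free cluster pattern with initial seed (B₀, x) at t₀

record ClusterPattern {n : ℕ} (B₀ : Mat n) (t₀ : Vertex n) : Set where
  field
    B : Vertex n → Mat n
    x : Vertex n → Fin n → LPoly n
    B-init : ∀ i j → B t₀ i j ≡ B₀ i j
    B-mut  : ∀ t k i j → B (step k t) i j ≡ mutate k (B t) i j
    x-init : ∀ i → x t₀ i ≈ var i
    x-keep : ∀ t k j → j ≢ k → x (step k t) j ≈ x t j
    x-exch : ∀ t k →
      (x (step k t) k ⊗ x t k) ≈
        (prodFin (λ l → x t l ^ᴸ pos (B t l k))
          ⊕ prodFin (λ l → x t l ^ᴸ pos (- B t l k)))

open ClusterPattern public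

IsDMatrix : ∀ {n} {B₀ : Mat n} {t₀ : Vertex n} →
            ClusterPattern B₀ t₀ → Vertex n → Mat n → Set
IsDMatrix X t D = ∀ i j → MinusLowestPower (x X t j) i (D i j)

AllDSigned : Set
AllDSigned = ∀ n (B₀ : Mat n) → SkewSymmetrizable B₀ →
  ∀ (t₀ t : Vertex n) (X : ClusterPattern B₀ t₀) (D : Mat n) →
  IsDMatrix X t D → SignedColumns D

StatementA : ℕ → Set
StatementA n = ∀ (B₀ : Mat n) → SkewSymmetrizable B₀ →
  ∀ (t₀ : Vertex n) (k : Fin n) → RowSignCoherent B₀ k →
  (X₀ : ClusterPattern B₀ t₀) (X₁ : ClusterPattern (mutate k B₀) (step k t₀)) →
  ∀ (t : Vertex n) (D₀ D₁ : Mat n) → IsDMatrix X₀ t D₀ → IsDMatrix X₁ t D₁ →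
  ∀ i j → D₁ i j ≡ ((J k ·ᴹ D₀) +ᴹ [ ∣ row-only k B₀ ∣ᴹ ·ᴹ D₀ ]₊ᴹ) i j

StatementB : ℕ → Set
StatementB n = ∀ (B₀ : Mat n) → SkewSymmetrizable B₀ →
  ∀ (t₀ : Vertex n) (k : Fin n) → RowSignCoherent B₀ k →
  (X₀ : ClusterPattern B₀ t₀) (X₁ : ClusterPattern (mutate k B₀) (step k t₀)) →
  ∀ (t : Vertex n) (D₀ D₁ : Mat n) → IsDMatrix X₀ t D₀ → IsDMatrix X₁ t D₁ →
  ∀ i j → D₁ i j ≡ σ B₀ k D₀ i j

module Submission where

-- Proposition 1.10 is a statement about matrices only: the cluster-algebraic
-- data (patterns, d-vectors, sign-coherence of row k) enter solely through
-- the hypothesis that every d-matrix has signed columns.  The heart of the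
-- proof is the identity, valid for any integer matrices B and D,
--
--     D has signed columns  ⇒  J_k D + [ |B^{k•}| D ]₊ = σ_k D   (entrywise),
--
-- where σ_k is built from B.  Row i ≠ k of both sides is D_i (J_k and B^{k•}
-- act trivially there).  In row k, J_k contributes -D_kj, and the positive
-- part of the nonnegative combination Σ_ℓ |b_kℓ| D_ℓj of the signed column
-- D_•j equals Σ_ℓ |b_kℓ| [D_ℓj]₊.

open import Defs
open import Data.Nat using (ℕ; zero; suc)
open import Data.Product using (_×_; _,_)
open import Data.Sum using (_⊎_; inj₁; inj₂)
open import Data.Fin using (Fin; _≟_)
import Data.Fin as Fin using (zero; suc)
open import Data.Bool using (true; false; if_then_else_)
open import Data.Empty using (⊥-elim)
open import Data.Integer using (ℤ; +_; _+_; _*_; -_; _≤_; 0ℤ; 1ℤ; ∣_∣)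
import Data.Integer.Properties as ℤP
open import Function using (case_of_)
open import Relation.Nullary using (yes; no; ¬_)
open import Relation.Binary.PropositionalEquality
  using (_≡_; refl; sym; trans; cong; cong₂; subst; module ≡-Reasoning)

eqF-refl : ∀ {n} (i : Fin n) → eqF i i ≡ true
eqF-refl i with i ≟ i
... | yes _ = refl
... | no i≢i = ⊥-elim (i≢i refl)

eqF-≢ : ∀ {n} {i j : Fin n} → ¬ i ≡ j → eqF i j ≡ false
eqF-≢ {i = i} {j} i≢j with i ≟ j
... | yes i≡j = ⊥-elim (i≢j i≡j)
... | no _ = refl

eqF-suc : ∀ {n} (i l : Fin n) → eqF (Fin.suc i) (Fin.suc l) ≡ eqF i l
eqF-suc i l with i ≟ l
... | yes refl = refl
... | no _ = refl

sumFin-cong : ∀ {n} {f g : Fin n → ℤ} → (∀ l → f l ≡ g l) → sumFin f ≡ sumFin g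
sumFin-cong {zero} f≗g = refl
sumFin-cong {suc n} f≗g = cong₂ _+_ (f≗g Fin.zero) (sumFin-cong (λ l → f≗g (Fin.suc l)))

sumFin-zero : ∀ {n} (f : Fin n → ℤ) → (∀ l → f l ≡ 0ℤ) → sumFin f ≡ 0ℤ
sumFin-zero {zero} f f≗0 = refl
sumFin-zero {suc n} f f≗0 =
  cong₂ _+_ (f≗0 Fin.zero) (sumFin-zero (λ l → f (Fin.suc l)) (λ l → f≗0 (Fin.suc l)))

sumFin-nonneg : ∀ {n} (f : Fin n → ℤ) → (∀ l → 0ℤ ≤ f l) → 0ℤ ≤ sumFin f
sumFin-nonneg {zero} f f≥0 = ℤP.≤-refl
sumFin-nonneg {suc n} f f≥0 =
  ℤP.+-mono-≤ (f≥0 Fin.zero) (sumFin-nonneg (λ l → f (Fin.suc l)) (λ l → f≥0 (Fin.suc l)))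

sumFin-nonpos : ∀ {n} (f : Fin n → ℤ) → (∀ l → f l ≤ 0ℤ) → sumFin f ≤ 0ℤ
sumFin-nonpos {zero} f f≤0 = ℤP.≤-refl
sumFin-nonpos {suc n} f f≤0 =
  ℤP.+-mono-≤ (f≤0 Fin.zero) (sumFin-nonpos (λ l → f (Fin.suc l)) (λ l → f≤0 (Fin.suc l)))

sumFin-delta : ∀ {n} (i : Fin n) (a : ℤ) (f : Fin n → ℤ) →
  sumFin (λ l → (if eqF i l then a else 0ℤ) * f l) ≡ a * f i
sumFin-delta {suc n} Fin.zero a f = begin
  a * f Fin.zero + sumFin (λ l → 0ℤ * f (Fin.suc l))
    ≡⟨ cong (λ s → a * f Fin.zero + s) (sumFin-zero {n} _ (λ _ → refl)) ⟩
  a * f Fin.zero + 0ℤ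
    ≡⟨ ℤP.+-identityʳ _ ⟩
  a * f Fin.zero ∎
  where open ≡-Reasoning
sumFin-delta {suc n} (Fin.suc i) a f = begin
  0ℤ + sumFin (λ l → (if eqF (Fin.suc i) (Fin.suc l) then a else 0ℤ) * f (Fin.suc l))
    ≡⟨ ℤP.+-identityˡ _ ⟩
  sumFin (λ l → (if eqF (Fin.suc i) (Fin.suc l) then a else 0ℤ) * f (Fin.suc l))
    ≡⟨ sumFin-cong (λ l → cong (λ b → (if b then a else 0ℤ) * f (Fin.suc l)) (eqF-suc i l)) ⟩
  sumFin (λ l → (if eqF i l then a else 0ℤ) * f (Fin.suc l))
    ≡⟨ sumFin-delta i a (λ l → f (Fin.suc l)) ⟩
  a * f (Fin.suc i) ∎
  where open ≡-Reasoning

-- Positive part of a nonnegative combination of a signed vector: if all v_ℓ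
-- have the same weak sign, then [Σ_ℓ w_ℓ v_ℓ]₊ = Σ_ℓ w_ℓ [v_ℓ]₊ for
-- natural-number weights w.  (Both sides are Σ w v, resp. both are 0.)
posPart-weightedSum : ∀ {n} (w : Fin n → ℕ) (v : Fin n → ℤ) →
  (∀ l → 0ℤ ≤ v l) ⊎ (∀ l → v l ≤ 0ℤ) →
  [ sumFin (λ l → + w l * v l) ]₊ ≡ sumFin (λ l → + w l * [ v l ]₊)
posPart-weightedSum w v (inj₁ v≥0) = begin
  [ sumFin (λ l → + w l * v l) ]₊
    ≡⟨ ℤP.i≥j⇒i⊔j≡i (sumFin-nonneg _ (λ l → weighted≥0 l)) ⟩
  sumFin (λ l → + w l * v l)
    ≡⟨ sumFin-cong (λ l → cong (+ w l *_) (sym (ℤP.i≥j⇒i⊔j≡i (v≥0 l)))) ⟩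
  sumFin (λ l → + w l * [ v l ]₊) ∎
  where
  open ≡-Reasoning
  weighted≥0 : ∀ l → 0ℤ ≤ + w l * v l
  weighted≥0 l = subst (_≤ + w l * v l) (ℤP.*-zeroʳ (+ w l)) (ℤP.*-monoˡ-≤-nonNeg (+ w l) (v≥0 l))
posPart-weightedSum w v (inj₂ v≤0) = begin
  [ sumFin (λ l → + w l * v l) ]₊
    ≡⟨ ℤP.i≤j⇒i⊔j≡j (sumFin-nonpos _ (λ l → weighted≤0 l)) ⟩
  0ℤ
    ≡⟨ sym (sumFin-zero _ (λ l → trans (cong (+ w l *_) (ℤP.i≤j⇒i⊔j≡j (v≤0 l))) (ℤP.*-zeroʳ (+ w l)))) ⟩
  sumFin (λ l → + w l * [ v l ]₊) ∎
  where
  open ≡-Reasoning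
  weighted≤0 : ∀ l → + w l * v l ≤ 0ℤ
  weighted≤0 l = subst (+ w l * v l ≤_) (ℤP.*-zeroʳ (+ w l)) (ℤP.*-monoˡ-≤-nonNeg (+ w l) (v≤0 l))

mutatedD : ∀ {n} → Mat n → Fin n → Mat n → Mat n
mutatedD B k D = (J k ·ᴹ D) +ᴹ [ ∣ row-only k B ∣ᴹ ·ᴹ D ]₊ᴹ

-- Row k: J_k negates D_kj, and the signed column lets [·]₊ pass inside the sum.
mutatedD-row-k : ∀ {n} (B D : Mat n) (k : Fin n) → SignedColumns D → ∀ j →
  mutatedD B k D k j ≡ σ B k D k j
mutatedD-row-k B D k signed j rewrite eqF-refl k = begin
  sumFin (λ l → (if eqF k l then - 1ℤ else 0ℤ) * D l j) + [ sumFin (λ l → ∣ B k l ∣ℤ * D l j) ]₊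
    ≡⟨ cong₂ _+_ (sumFin-delta k (- 1ℤ) (λ l → D l j))
                 (posPart-weightedSum (λ l → ∣ B k l ∣) (λ l → D l j) (signed j)) ⟩
  - 1ℤ * D k j + sumFin (λ l → ∣ B k l ∣ℤ * [ D l j ]₊)
    ≡⟨ cong (_+ sumFin (λ l → ∣ B k l ∣ℤ * [ D l j ]₊)) (ℤP.-1*i≡-i (D k j)) ⟩
  - D k j + sumFin (λ l → ∣ B k l ∣ℤ * [ D l j ]₊) ∎
  where open ≡-Reasoning

-- Row i ≠ k: J_k acts as the identity and B^{k•} vanishes, so D_ij is kept.
mutatedD-row-≠k : ∀ {n} (B D : Mat n) (k i : Fin n) → ¬ i ≡ k → ∀ j →
  mutatedD B k D i j ≡ σ B k D i j
mutatedD-row-≠k {n} B D k i i≢k j rewrite eqF-≢ i≢k = begin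
  sumFin (λ l → (if eqF i l then 1ℤ else 0ℤ) * D l j) + [ sumFin {n} (λ _ → 0ℤ) ]₊
    ≡⟨ cong₂ _+_ (sumFin-delta i 1ℤ (λ l → D l j)) (cong [_]₊ (sumFin-zero {n} _ (λ _ → refl))) ⟩
  1ℤ * D i j + 0ℤ
    ≡⟨ ℤP.+-identityʳ _ ⟩
  1ℤ * D i j
    ≡⟨ ℤP.*-identityˡ _ ⟩
  D i j ∎
  where open ≡-Reasoning

mutatedD≡σ : ∀ {n} (B D : Mat n) (k : Fin n) → SignedColumns D → ∀ i j →
  mutatedD B k D i j ≡ σ B k D i j
mutatedD≡σ B D k signed i j = case i ≟ k of λ where
  (yes refl) → mutatedD-row-k B D k signed j
  (no i≢k) → mutatedD-row-≠k B D k i i≢k j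

-- Since D_t^{B₀;t₀} has signed columns, the right-hand sides of (a) and (b)
-- coincide, so each statement follows from the other.
proposition1p10 : AllDSigned → ∀ (n : ℕ) → (StatementA n → StatementB n) × (StatementB n → StatementA n)
proposition1p10 allSigned n = a⇒b , b⇒a
  where
  a⇒b : StatementA n → StatementB n
  a⇒b a B₀ skew t₀ k coherent X₀ X₁ t D₀ D₁ isD₀ isD₁ i j =
    trans (a B₀ skew t₀ k coherent X₀ X₁ t D₀ D₁ isD₀ isD₁ i j)
          (mutatedD≡σ B₀ D₀ k (allSigned n B₀ skew t₀ t X₀ D₀ isD₀) i j)
  b⇒a : StatementB n → StatementA n
  b⇒a b B₀ skew t₀ k coherent X₀ X₁ t D₀ D₁ isD₀ isD₁ i j =
    trans (b B₀ skew t₀ k coherent X₀ X₁ t D₀ D₁ isD₀ isD₁ i j)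
          (sym (mutatedD≡σ B₀ D₀ k (allSigned n B₀ skew t₀ t X₀ D₀ isD₀) i j))
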